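{- Let $\mathbf S=(S,\leq,*,1)$ be a skew Hilbert algebra and $F$ a $*$-filter of $\mathbf S$. Then $\Phi(F)$ is an algebraic congruence on $\mathbf S$ and $[1](\Phi(F))=F$.
   Context: For a poset and a subset $A$, $L(A)$, $U(A)$ are the sets of lower and upper bounds; $L(U(x,y),z)=L(U(\{x,y\})\cup\{z\})$. A skew Hilbert algebra is a poset $(S,\leq,*,1)$ with binary operation $*$ and constant $1$ such that for all $x,y,z$: (S1) $x\leq y$ iff $x*y=1$; (S2) if $y*x=1$ then $x*((x*y)*y)=1$; (S3) if $x*y=1$ then $(y*z)*(x*z)=1$; (S4) $L(U(x,y),x*y)=L(y)$. A $*$-filter of $\mathbf S$ is a subset $F\subseteq S$ with $1\in F$ such that for all $x,y,z,v\in S$: if $x*y,y*x,z*v,v*z\in F$ then $(x*z)*(y*v)\in F$. $\Phi(M)=\{(x,y)\in S^2\mid x*y,y*x\in M\}$. An algebraic congruence on $\mathbf S$ is a congruence of the groupoid $(S,*)$. -}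

module Defs where

open import Level using (Level; _⊔_; suc)
open import Data.Product using (_×_; _,_)
open import Relation.Binary.PropositionalEquality using (_≡_)
open import Relation.Binary.Structures using (IsPartialOrder)
open import Relation.Binary.Definitions using (Reflexive; Symmetric; Transitive)

record SkewHilbertAlgebra (a ℓ : Level) : Set (suc (a ⊔ ℓ)) where
  infix 4 _≤_
  infixr 7 _*_
  field
    Carrier        : Set a
    _≤_            : Carrier → Carrier → Set ℓ
    _*_            : Carrier → Carrier → Carrier
    𝟏              : Carrier
    isPartialOrder : IsPartialOrder _≡_ _≤_
    S1 : ∀ x y → (x ≤ y → x * y ≡ 𝟏) × (x * y ≡ 𝟏 → x ≤ y)
    S2 : ∀ x y → y * x ≡ 𝟏 → x * ((x * y) * y) ≡ 𝟏
    S3 : ∀ x y z → x * y ≡ 𝟏 → (y * z) * (x * z) ≡ 𝟏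
    -- (S4) L(U(x,y), x * y) = L(y), as sets of elements
    S4 : ∀ x y w →
         (((∀ u → x ≤ u → y ≤ u → w ≤ u) × w ≤ x * y) → w ≤ y)
         × (w ≤ y → ((∀ u → x ≤ u → y ≤ u → w ≤ u) × w ≤ x * y))

module _ {a ℓ : Level} (𝐒 : SkewHilbertAlgebra a ℓ) where
  open SkewHilbertAlgebra 𝐒

  Subset : (p : Level) → Set (a ⊔ suc p)
  Subset p = Carrier → Set p

  IsStarFilter : ∀ {p} → Subset p → Set (a ⊔ p)
  IsStarFilter F =
    F 𝟏 ×
    (∀ x y z v → F (x * y) → F (y * x) → F (z * v) → F (v * z)
               → F ((x * z) * (y * v)))

  Φ : ∀ {p} → Subset p → Carrier → Carrier → Set p
  Φ M x y = M (x * y) × M (y * x)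

  IsAlgebraicCongruence : ∀ {r} → (Carrier → Carrier → Set r) → Set (a ⊔ r)
  IsAlgebraicCongruence θ =
    Reflexive θ × Symmetric θ × Transitive θ ×
    (∀ x y z v → θ x y → θ z v → θ (x * z) (y * v))

  classOf1 : ∀ {r} → (Carrier → Carrier → Set r) → Subset r
  classOf1 θ x = θ x 𝟏

-- Only (S1), the reflexive instance of (S4), and the axioms of a poset are needed. They make
-- 1 the top element with x * x = 1, x * 1 = 1 and 1 * x = x. Transitivity
-- comes from compatibility applied to (y, x) and (y, z), which puts (y * y) * (x * z) = x * z
-- into F. The class of 1 is F because x * 1 = 1 ∈ F and 1 * x = x.
module Submission where

open import Defs
open import Level using (Level)
open import Data.Product using (_×_; _,_; proj₁; proj₂; swap)
open import Relation.Binary.PropositionalEquality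
  using (_≡_; refl; sym; subst; cong; module ≡-Reasoning)
open import Relation.Binary.Structures using (IsPartialOrder)

module SkewHilbertAlgebraProperties {a ℓ : Level} (𝐒 : SkewHilbertAlgebra a ℓ) where
  open SkewHilbertAlgebra 𝐒
  open IsPartialOrder isPartialOrder using (antisym; reflexive) renaming (refl to ≤-refl)

  x*x≡𝟏 : ∀ x → x * x ≡ 𝟏
  x*x≡𝟏 x = proj₁ (S1 x x) ≤-refl

  y≤x*y : ∀ x y → y ≤ x * y
  y≤x*y x y = proj₂ (proj₂ (S4 x y y) ≤-refl)

  𝟏≤x⇒x≡𝟏 : ∀ {x} → 𝟏 ≤ x → x ≡ 𝟏
  𝟏≤x⇒x≡𝟏 {x} 𝟏≤x = antisym (subst (x ≤_) (proj₁ (S1 𝟏 x) 𝟏≤x) (y≤x*y 𝟏 x)) 𝟏≤x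

  x*𝟏≡𝟏 : ∀ x → x * 𝟏 ≡ 𝟏
  x*𝟏≡𝟏 x = antisym (proj₁ (S4 x 𝟏 (x * 𝟏)) (below-upper-bounds , ≤-refl)) (y≤x*y x 𝟏)
    where
    below-upper-bounds : ∀ u → x ≤ u → 𝟏 ≤ u → x * 𝟏 ≤ u
    below-upper-bounds u x≤u 𝟏≤u with 𝟏≤x⇒x≡𝟏 𝟏≤u
    ... | refl = reflexive (proj₁ (S1 x 𝟏) x≤u)

  x≤𝟏 : ∀ x → x ≤ 𝟏
  x≤𝟏 x = proj₂ (S1 x 𝟏) (x*𝟏≡𝟏 x)

  𝟏*x≡x : ∀ x → 𝟏 * x ≡ x
  𝟏*x≡x x = antisym (proj₁ (S4 𝟏 x (𝟏 * x)) (below-upper-bounds , ≤-refl)) (y≤x*y 𝟏 x)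
    where
    below-upper-bounds : ∀ u → 𝟏 ≤ u → x ≤ u → 𝟏 * x ≤ u
    below-upper-bounds u 𝟏≤u _ with 𝟏≤x⇒x≡𝟏 𝟏≤u
    ... | refl = x≤𝟏 (𝟏 * x)

  [y*y]*x≡x : ∀ y x → (y * y) * x ≡ x
  [y*y]*x≡x y x = begin
    (y * y) * x ≡⟨ cong (_* x) (x*x≡𝟏 y) ⟩
    𝟏 * x       ≡⟨ 𝟏*x≡x x ⟩
    x           ∎
    where open ≡-Reasoning

module StarFilterProperties
  {a ℓ p : Level} (𝐒 : SkewHilbertAlgebra a ℓ)
  (F : SkewHilbertAlgebra.Carrier 𝐒 → Set p) (isStarFilter : IsStarFilter 𝐒 F) where
  open SkewHilbertAlgebra 𝐒
  open SkewHilbertAlgebraProperties 𝐒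

  private
    𝟏∈F : F 𝟏
    𝟏∈F = proj₁ isStarFilter

  Φ-compatible : ∀ x y z v → Φ 𝐒 F x y → Φ 𝐒 F z v → Φ 𝐒 F (x * z) (y * v)
  Φ-compatible x y z v (xy , yx) (zv , vz) =
    proj₂ isStarFilter x y z v xy yx zv vz , proj₂ isStarFilter y x v z yx xy vz zv

  Φ-refl : ∀ {x} → Φ 𝐒 F x x
  Φ-refl {x} = F[x*x] , F[x*x]
    where
    F[x*x] : F (x * x)
    F[x*x] = subst F (sym (x*x≡𝟏 x)) 𝟏∈F

  Φ-sym : ∀ {x y} → Φ 𝐒 F x y → Φ 𝐒 F y x
  Φ-sym = swap

  Φ-trans : ∀ {x y z} → Φ 𝐒 F x y → Φ 𝐒 F y z → Φ 𝐒 F x z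
  Φ-trans xΦy yΦz = x*z∈F xΦy yΦz , x*z∈F (Φ-sym yΦz) (Φ-sym xΦy)
    where
    x*z∈F : ∀ {x y z} → Φ 𝐒 F x y → Φ 𝐒 F y z → F (x * z)
    x*z∈F {x} {y} {z} xΦy yΦz =
      subst F ([y*y]*x≡x y (x * z)) (proj₁ (Φ-compatible y x y z (Φ-sym xΦy) yΦz))

  Φ-isAlgebraicCongruence : IsAlgebraicCongruence 𝐒 (Φ 𝐒 F)
  Φ-isAlgebraicCongruence = Φ-refl , Φ-sym , Φ-trans , Φ-compatible

  classOf1-Φ⇒F : ∀ {x} → classOf1 𝐒 (Φ 𝐒 F) x → F x
  classOf1-Φ⇒F {x} (_ , 𝟏*x∈F) = subst F (𝟏*x≡x x) 𝟏*x∈F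

  F⇒classOf1-Φ : ∀ {x} → F x → classOf1 𝐒 (Φ 𝐒 F) x
  F⇒classOf1-Φ {x} x∈F = subst F (sym (x*𝟏≡𝟏 x)) 𝟏∈F , subst F (sym (𝟏*x≡x x)) x∈F

mainTheorem15 : {a ℓ p : Level} (𝐒 : SkewHilbertAlgebra a ℓ)
    (F : SkewHilbertAlgebra.Carrier 𝐒 → Set p) →
    IsStarFilter 𝐒 F →
    IsAlgebraicCongruence 𝐒 (Φ 𝐒 F) ×
    (∀ x → (classOf1 𝐒 (Φ 𝐒 F) x → F x) × (F x → classOf1 𝐒 (Φ 𝐒 F) x))
mainTheorem15 𝐒 F isStarFilter =
  Φ-isAlgebraicCongruence , λ _ → classOf1-Φ⇒F , F⇒classOf1-Φ
  where open StarFilterProperties 𝐒 F isStarFilter
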